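{- There are infinitely many oriented graphs $G$ with $\delta^0(G)=(3|G|-4)/8$ which do not contain an anti-directed Hamilton cycle.
   Context: An oriented graph is a digraph obtained by orienting a simple undirected graph (so no pair $x,y$ has both $xy$ and $yx$ as edges). $\delta^0(G)=\min(\delta^+(G),\delta^-(G))$ is the minimum semidegree and $|G|$ the number of vertices. An anti-directed Hamilton cycle is a Hamilton cycle (of the underlying graph, contained in $G$) whose edge orientations alternate along the cycle. -}

module Defs where

open import Data.Nat using (ℕ; zero; suc; _+_; _*_; _≤_; _≥_; _%_)
open import Data.Fin using (Fin; toℕ) renaming (zero to fzero; suc to fsuc)
open import Data.Fin.Properties using (any?)
open import Data.Product using (Σ; _×_; _,_; ∃)
open import Data.Sum using (_⊎_)
open import Data.Empty using (⊥)
open import Relation.Nullary using (¬_; Dec)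
open import Relation.Nullary.Decidable using (⌊_⌋)
open import Relation.Binary.PropositionalEquality using (_≡_)
open import Data.Bool using (Bool; true; false; if_then_else_)
open import Function.Bundles using (_↔_; Inverse)
open import Data.Nat.Divisibility using (_∣_)

record Digraph (n : ℕ) : Set₁ where
  field
    E    : Fin n → Fin n → Set
    dec  : ∀ x y → Dec (E x y)
open Digraph public

IsOriented : ∀ {n} → Digraph n → Set
IsOriented G = (∀ x → ¬ E G x x) × (∀ x y → E G x y → ¬ E G y x)

count : ∀ {n} → (Fin n → Bool) → ℕ
count {zero}  p = 0
count {suc n} p = (if p fzero then 1 else 0) + count (λ i → p (fsuc i))

outdeg : ∀ {n} → Digraph n → Fin n → ℕ
outdeg G x = count (λ y → ⌊ dec G x y ⌋)

indeg : ∀ {n} → Digraph n → Fin n → ℕ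
indeg G x = count (λ y → ⌊ dec G y x ⌋)

MinSemidegree : ∀ {n} → Digraph n → ℕ → Set
MinSemidegree G d =
  (∀ x → d ≤ outdeg G x × d ≤ indeg G x)
  × (∃ λ x → outdeg G x ≡ d ⊎ indeg G x ≡ d)

CycSucc : ∀ {n} → Fin n → Fin n → Set
CycSucc {n} i j = (toℕ j ≡ suc (toℕ i)) ⊎ ((suc (toℕ i) ≡ n) × (toℕ j ≡ 0))

-- An anti-directed Hamilton cycle: a cyclic ordering σ of all vertices
-- (a bijection Fin n ↔ Fin n, σ i = i-th vertex on the cycle), n ≥ 3,
-- such that consecutive edges alternate in orientation. Alternation
-- around a cycle forces n even; position i (with i+1 taken mod n)
-- is traversed forwards if i is even and backwards if i is odd.
record AntiDirectedHamCycle {n : ℕ} (G : Digraph n) : Set where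
  field
    n≥3   : n ≥ 3
    even  : 2 ∣ n
    σ     : Fin n ↔ Fin n
    edges : ∀ (i j : Fin n) → CycSucc i j →
              (2 ∣ toℕ i → E G (Inverse.to σ i) (Inverse.to σ j))
            × (¬ (2 ∣ toℕ i) → E G (Inverse.to σ j) (Inverse.to σ i))

-- Split 4(2k + 1) vertices into parts A, B, C, D of size 2k + 1 and give each part a pair of colours
-- (src, snk): A = (1,1), B = (0,1), C = (0,0), D = (1,0). An arc may go from part p to part q only if
-- src p = snk q; parts allowed in both directions (A–A, C–C, B–D) are joined by a regular tournament,
-- parts allowed in one direction (A → B → C → D → A) completely. Every vertex then has in- and
-- out-degree (2k + 1) + k. Along an anti-directed cycle even positions are tails and odd positions heads
-- of both incident arcs, so reading src at even and snk at odd positions gives a constant colour; it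
-- would be 1 at a vertex of A and 0 at a vertex of C.
module Submission where

open import Defs
open import Data.Nat using (ℕ; _+_; _*_; _≥_)
open import Data.Product using (Σ; _×_)
open import Relation.Nullary using (¬_)
open import Relation.Binary.PropositionalEquality using (_≡_)

open import Data.Bool using (Bool; true; false; not; if_then_else_; T)
open import Data.Bool.Properties using (not-involutive; T-≡) renaming (_≟_ to _≟ᵇ_)
open import Data.Empty using (⊥-elim)
open import Data.Fin using (Fin; zero; suc; toℕ; inject₁; remQuot; combine; _↑ˡ_; _↑ʳ_)
open import Data.Fin.Induction using (<-weakInduction)
open import Data.Fin.Patterns using (0F; 1F; 2F; 3F)
open import Data.Fin.Properties using (toℕ-inject₁; splitAt-↑ʳ; remQuot-combine)
open import Data.Nat using (zero; suc; _≤_; _<ᵇ_; _∸_; s≤s)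
open import Data.Nat.Divisibility using (_∣_; _∣?_; ∣-refl; _∣0; ∣1⇒≡1; ∣m+n∣m⇒∣n; ∣m∣n⇒∣m+n)
open import Data.Nat.Properties using (≤-reflexive; ≤-trans; +-comm; +-identityʳ; +-assoc; m≤m+n; m+n∸m≡n)
open import Data.Nat.Tactic.RingSolver using (solve-∀)
open import Data.Product using (_,_; proj₁; proj₂; map₁)
open import Data.Sum using (inj₁)
open import Data.Vec.Functional using (foldr)
open import Function using (_∘_; case_of_)
open import Function.Bundles using (Inverse; Equivalence)
open import Relation.Nullary using (Dec; yes; no; does)
open import Relation.Nullary.Decidable using (T?; isYes≗does)
open import Relation.Binary.PropositionalEquality using (refl; sym; trans; cong; cong₂; subst; module ≡-Reasoning)

count-cong : ∀ {n} {f g : Fin n → Bool} → (∀ i → f i ≡ g i) → count f ≡ count g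
count-cong {zero}  f≗g = refl
count-cong {suc n} f≗g =
  cong₂ (λ b c → (if b then 1 else 0) + c) (f≗g zero) (count-cong (f≗g ∘ suc))

count-false : ∀ n → count {n} (λ _ → false) ≡ 0
count-false zero    = refl
count-false (suc n) = count-false n

count-true : ∀ n → count {n} (λ _ → true) ≡ n
count-true zero    = refl
count-true (suc n) = cong suc (count-true n)

count-++ : ∀ a {b} (f : Fin (a + b) → Bool) →
           count f ≡ count (λ i → f (i ↑ˡ b)) + count (λ j → f (a ↑ʳ j))
count-++ zero    f = refl
count-++ (suc a) f =
  trans (cong ((if f zero then 1 else 0) +_) (count-++ a (f ∘ suc)))
        (sym (+-assoc (if f zero then 1 else 0) _ _))

count-remQuot : ∀ a {b} (g : Fin a × Fin b → Bool) (w : Fin a → ℕ) →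
                (∀ i → count (λ j → g (i , j)) ≡ w i) →
                count (g ∘ remQuot b) ≡ foldr _+_ 0 w
count-remQuot zero    g w count≡w = refl
count-remQuot (suc a) {b} g w count≡w = begin
  count (g ∘ remQuot b)
    ≡⟨ count-++ b (g ∘ remQuot b) ⟩
  count (λ j → g (remQuot b (combine {suc a} zero j))) + count (λ x → g (remQuot {suc a} b (b ↑ʳ x)))
    ≡⟨ cong₂ _+_ (count-cong λ j → cong g (remQuot-combine zero j))
                 (count-cong λ x → cong g (remQuot-↑ʳ x)) ⟩
  count (λ j → g (zero , j)) + count (g ∘ map₁ suc ∘ remQuot {a} b)
    ≡⟨ cong₂ _+_ (count≡w zero) (count-remQuot a (g ∘ map₁ suc) (w ∘ suc) (count≡w ∘ suc)) ⟩
  foldr _+_ 0 w ∎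
  where
  open ≡-Reasoning
  remQuot-↑ʳ : ∀ x → remQuot {suc a} b (b ↑ʳ x) ≡ map₁ suc (remQuot b x)
  remQuot-↑ʳ x rewrite splitAt-↑ʳ b (a * b) x = refl

count-<ᵇ : ∀ {n} k → k ≤ n → count {n} (λ x → toℕ x <ᵇ k) ≡ k
count-<ᵇ {n}     zero    _         = count-false n
count-<ᵇ {suc n} (suc k) (s≤s k≤n) = cong suc (count-<ᵇ k k≤n)

count-≮ᵇ : ∀ {n} k → k ≤ n → count {n} (λ x → not (toℕ x <ᵇ k)) ≡ n ∸ k
count-≮ᵇ {n}     zero    _         = count-true n
count-≮ᵇ {suc n} (suc k) (s≤s k≤n) = count-≮ᵇ k k≤n

-- New vertices 0 → 1 are added: 0 beats the first k old vertices and 1 the other k + 1, so every old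
-- vertex gains one out- and one in-neighbour.
tournament : ∀ k → Fin (suc (k * 2)) → Fin (suc (k * 2)) → Bool
tournament zero    _             _             = false
tournament (suc k) 0F            0F            = false
tournament (suc k) 0F            1F            = true
tournament (suc k) 0F            (suc (suc y)) = toℕ y <ᵇ k
tournament (suc k) 1F            0F            = false
tournament (suc k) 1F            1F            = false
tournament (suc k) 1F            (suc (suc y)) = not (toℕ y <ᵇ k)
tournament (suc k) (suc (suc x)) 0F            = not (toℕ x <ᵇ k)
tournament (suc k) (suc (suc x)) 1F            = toℕ x <ᵇ k
tournament (suc k) (suc (suc x)) (suc (suc y)) = tournament k x y

tournament-irrefl : ∀ k x → tournament k x x ≡ false
tournament-irrefl zero    _             = refl
tournament-irrefl (suc k) 0F            = refl
tournament-irrefl (suc k) 1F            = refl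
tournament-irrefl (suc k) (suc (suc x)) = tournament-irrefl k x

tournament-antisym : ∀ k x y → tournament k x y ≡ true → tournament k y x ≡ false
tournament-antisym zero    _             _             ()
tournament-antisym (suc k) 0F            1F            _  = refl
tournament-antisym (suc k) 0F            (suc (suc y)) xy = cong not xy
tournament-antisym (suc k) 1F            (suc (suc y)) xy = trans (sym (not-involutive _)) (cong not xy)
tournament-antisym (suc k) (suc (suc x)) 0F            xy = trans (sym (not-involutive _)) (cong not xy)
tournament-antisym (suc k) (suc (suc x)) 1F            xy = cong not xy
tournament-antisym (suc k) (suc (suc x)) (suc (suc y)) xy = tournament-antisym k x y xy

private
  1+2k≡k+[1+k] : ∀ k → suc (k * 2) ≡ k + suc k
  1+2k≡k+[1+k] = solve-∀

  k≤1+2k : ∀ k → k ≤ suc (k * 2)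
  k≤1+2k k = subst (k ≤_) (sym (1+2k≡k+[1+k] k)) (m≤m+n k (suc k))

  1+2k∸k≡1+k : ∀ k → suc (k * 2) ∸ k ≡ suc k
  1+2k∸k≡1+k k = trans (cong (_∸ k) (1+2k≡k+[1+k] k)) (m+n∸m≡n k (suc k))

  not-b+b : ∀ b n → (if not b then 1 else 0) + ((if b then 1 else 0) + n) ≡ suc n
  not-b+b true  n = refl
  not-b+b false n = refl

  b+not-b : ∀ b n → (if b then 1 else 0) + ((if not b then 1 else 0) + n) ≡ suc n
  b+not-b true  n = refl
  b+not-b false n = refl

tournament-outdegree : ∀ k x → count (tournament k x) ≡ k
tournament-outdegree zero    _             = refl
tournament-outdegree (suc k) 0F            = cong suc (count-<ᵇ k (k≤1+2k k))
tournament-outdegree (suc k) 1F            = trans (count-≮ᵇ k (k≤1+2k k)) (1+2k∸k≡1+k k)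
tournament-outdegree (suc k) (suc (suc x)) =
  trans (not-b+b (toℕ x <ᵇ k) _) (cong suc (tournament-outdegree k x))

tournament-indegree : ∀ k y → count (λ x → tournament k x y) ≡ k
tournament-indegree zero    _             = refl
tournament-indegree (suc k) 0F            = trans (count-≮ᵇ k (k≤1+2k k)) (1+2k∸k≡1+k k)
tournament-indegree (suc k) 1F            = cong suc (count-<ᵇ k (k≤1+2k k))
tournament-indegree (suc k) (suc (suc y)) =
  trans (b+not-b (toℕ y <ᵇ k) _) (cong suc (tournament-indegree k y))

even⇒odd-suc : ∀ {n} → 2 ∣ n → ¬ 2 ∣ suc n
even⇒odd-suc {n} 2∣n 2∣1+n with ∣1⇒≡1 (∣m+n∣m⇒∣n (subst (2 ∣_) (+-comm 1 n) 2∣1+n) 2∣n)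
... | ()

odd⇒even-suc : ∀ n → ¬ 2 ∣ n → 2 ∣ suc n
odd⇒even-suc zero          2∤0   = ⊥-elim (2∤0 (2 ∣0))
odd⇒even-suc (suc zero)    _     = ∣-refl
odd⇒even-suc (suc (suc n)) 2∤2+n = ∣m∣n⇒∣m+n ∣-refl (odd⇒even-suc n (2∤2+n ∘ ∣m∣n⇒∣m+n ∣-refl))

constant-along-suc : ∀ {n} {A : Set} (f : Fin n → A) →
                     (∀ p q → toℕ q ≡ suc (toℕ p) → f p ≡ f q) → ∀ p q → f p ≡ f q
constant-along-suc {suc n} f step p q = trans (from-zero p) (sym (from-zero q))
  where
  from-zero : ∀ p → f p ≡ f zero
  from-zero = <-weakInduction (λ p → f p ≡ f zero) refl
    (λ p f[p]≡f[0] → trans (sym (step (inject₁ p) (suc p) (cong suc (sym (toℕ-inject₁ p))))) f[p]≡f[0])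

antiDirectedHamCycle⇒balanced-agree :
  ∀ {n} (G : Digraph n) (s t : Fin n → Bool) → (∀ x y → E G x y → s x ≡ t y) →
  AntiDirectedHamCycle G → ∀ a b → s a ≡ t a → s b ≡ t b → s a ≡ s b
antiDirectedHamCycle⇒balanced-agree {n} G s t arc⇒s≡t H a b sa≡ta sb≡tb =
  trans (sym (balanced a sa≡ta))
        (trans (constant-along-suc colour colour-step (from a) (from b)) (balanced b sb≡tb))
  where
  open AntiDirectedHamCycle H
  open Inverse σ using (to; from; strictlyInverseˡ)

  pick : ∀ {P : Set} → Dec P → Fin n → Bool
  pick (yes _) v = s v
  pick (no  _) v = t v

  colour : Fin n → Bool
  colour p = pick (2 ∣? toℕ p) (to p)

  pick-step : ∀ p q → toℕ q ≡ suc (toℕ p) → (p? : Dec (2 ∣ toℕ p)) (q? : Dec (2 ∣ toℕ q)) →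
              pick p? (to p) ≡ pick q? (to q)
  pick-step p q q≡1+p (yes 2∣p) (yes 2∣q) = ⊥-elim (even⇒odd-suc 2∣p (subst (2 ∣_) q≡1+p 2∣q))
  pick-step p q q≡1+p (yes 2∣p) (no  _)   = arc⇒s≡t _ _ (proj₁ (edges p q (inj₁ q≡1+p)) 2∣p)
  pick-step p q q≡1+p (no  2∤p) (yes _)   = sym (arc⇒s≡t _ _ (proj₂ (edges p q (inj₁ q≡1+p)) 2∤p))
  pick-step p q q≡1+p (no  2∤p) (no  2∤q) =
    ⊥-elim (2∤q (subst (2 ∣_) (sym q≡1+p) (odd⇒even-suc _ 2∤p)))

  colour-step : ∀ p q → toℕ q ≡ suc (toℕ p) → colour p ≡ colour q
  colour-step p q q≡1+p = pick-step p q q≡1+p (2 ∣? toℕ p) (2 ∣? toℕ q)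

  balanced : ∀ v → s v ≡ t v → colour (from v) ≡ s v
  balanced v sv≡tv with 2 ∣? toℕ (from v)
  ... | yes _ = cong s (strictlyInverseˡ v)
  ... | no  _ = trans (cong t (strictlyInverseˡ v)) (sym sv≡tv)

booleanDigraph : ∀ {n} → (Fin n → Fin n → Bool) → Digraph n
booleanDigraph e = record { E = λ x y → T (e x y) ; dec = λ x y → T? (e x y) }

outdeg-booleanDigraph : ∀ {n} (e : Fin n → Fin n → Bool) x → outdeg (booleanDigraph e) x ≡ count (e x)
outdeg-booleanDigraph e x = count-cong λ y → isYes≗does (T? (e x y))

indeg-booleanDigraph : ∀ {n} (e : Fin n → Fin n → Bool) y → indeg (booleanDigraph e) y ≡ count (λ x → e x y)
indeg-booleanDigraph e y = count-cong λ x → isYes≗does (T? (e x y))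

regular⇒minSemidegree : ∀ {n} (G : Digraph n) d → Fin n →
                        (∀ x → outdeg G x ≡ d) → (∀ x → indeg G x ≡ d) → MinSemidegree G d
regular⇒minSemidegree G d x₀ out≡d in≡d =
  (λ x → ≤-reflexive (sym (out≡d x)) , ≤-reflexive (sym (in≡d x))) , x₀ , inj₁ (out≡d x₀)

module BlowUp {m r : ℕ} (R : Fin m → Fin m → Bool)
              (R-irrefl : ∀ x → R x x ≡ false) (R-antisym : ∀ x y → R x y ≡ true → R y x ≡ false)
              (R-out : ∀ x → count (R x) ≡ r) (R-in : ∀ y → count (λ x → R x y) ≡ r) where

  Part : Set
  Part = Fin 4

  pattern A = 0F
  pattern B = 1F
  pattern C = 2F
  pattern D = 3F

  src snk : Part → Bool
  src A = true
  src B = false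
  src C = false
  src D = true
  snk A = true
  snk B = true
  snk C = false
  snk D = false

  data Connection : Set where
    noArcs allArcs bothWays : Connection

  connectionOf : Bool → Bool → Connection
  connectionOf true  true  = bothWays
  connectionOf true  false = allArcs
  connectionOf false _     = noArcs

  connection : Part → Part → Connection
  connection p q = connectionOf (does (src p ≟ᵇ snk q)) (does (src q ≟ᵇ snk p))

  arcs : Connection → Fin m → Fin m → Bool
  arcs noArcs   _ _ = false
  arcs allArcs  _ _ = true
  arcs bothWays i j = R i j

  weight : Connection → ℕ
  weight noArcs   = 0
  weight allArcs  = m
  weight bothWays = r

  arcs-outdegree : ∀ c i → count (arcs c i) ≡ weight c
  arcs-outdegree noArcs   _ = count-false m
  arcs-outdegree allArcs  _ = count-true m
  arcs-outdegree bothWays i = R-out i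

  arcs-indegree : ∀ c j → count (λ i → arcs c i j) ≡ weight c
  arcs-indegree noArcs   _ = count-false m
  arcs-indegree allArcs  _ = count-true m
  arcs-indegree bothWays j = R-in j

  arcs-loopless : ∀ b i → arcs (connectionOf b b) i i ≡ false
  arcs-loopless true  i = R-irrefl i
  arcs-loopless false _ = refl

  arcs-antisym : ∀ b b' i j → arcs (connectionOf b b') i j ≡ true → arcs (connectionOf b' b) j i ≡ false
  arcs-antisym true  true  i j ij = R-antisym i j ij
  arcs-antisym true  false _ _ _  = refl

  arcs-allowed : ∀ {P : Set} (P? : Dec P) b i j → arcs (connectionOf (does P?) b) i j ≡ true → P
  arcs-allowed (yes p) _ _ _ _ = p

  private
    m+[r+0]≡m+r : m + (r + 0) ≡ m + r
    m+[r+0]≡m+r = cong (m +_) (+-identityʳ r)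

    r+[m+0]≡m+r : r + (m + 0) ≡ m + r
    r+[m+0]≡m+r = trans (+-comm r (m + 0)) (cong (_+ r) (+-identityʳ m))

  Vertex : Set
  Vertex = Part × Fin m

  edge : Vertex → Vertex → Bool
  edge (p , i) (q , j) = arcs (connection p q) i j

  out-weight : ∀ p → foldr _+_ 0 (λ q → weight (connection p q)) ≡ m + r
  out-weight A = r+[m+0]≡m+r
  out-weight B = m+[r+0]≡m+r
  out-weight C = r+[m+0]≡m+r
  out-weight D = m+[r+0]≡m+r

  in-weight : ∀ q → foldr _+_ 0 (λ p → weight (connection p q)) ≡ m + r
  in-weight A = r+[m+0]≡m+r
  in-weight B = m+[r+0]≡m+r
  in-weight C = m+[r+0]≡m+r
  in-weight D = r+[m+0]≡m+r

  vertex-outdegree : ∀ v → count (edge v ∘ remQuot m) ≡ m + r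
  vertex-outdegree (p , i) =
    trans (count-remQuot 4 (edge (p , i)) _ (λ q → arcs-outdegree (connection p q) i)) (out-weight p)

  vertex-indegree : ∀ w → count ((λ v → edge v w) ∘ remQuot m) ≡ m + r
  vertex-indegree (q , j) =
    trans (count-remQuot 4 (λ v → edge v (q , j)) _ (λ p → arcs-indegree (connection p q) j)) (in-weight q)

  edge-loopless : ∀ v → edge v v ≡ false
  edge-loopless (p , i) = arcs-loopless (does (src p ≟ᵇ snk p)) i

  edge-antisym : ∀ v w → edge v w ≡ true → edge w v ≡ false
  edge-antisym (p , i) (q , j) = arcs-antisym (does (src p ≟ᵇ snk q)) (does (src q ≟ᵇ snk p)) i j

  edge⇒src≡snk : ∀ v w → edge v w ≡ true → src (proj₁ v) ≡ snk (proj₁ w)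
  edge⇒src≡snk (p , i) (q , j) = arcs-allowed (src p ≟ᵇ snk q) _ i j

  vertex : Fin (4 * m) → Vertex
  vertex = remQuot m

  index : Vertex → Fin (4 * m)
  index (p , i) = combine p i

  vertex-index : ∀ v → vertex (index v) ≡ v
  vertex-index (p , i) = remQuot-combine p i

  blowUp-edge : Fin (4 * m) → Fin (4 * m) → Bool
  blowUp-edge x y = edge (vertex x) (vertex y)

  blowUp : Digraph (4 * m)
  blowUp = booleanDigraph blowUp-edge

  blowUp-arc : ∀ x y → E blowUp x y → blowUp-edge x y ≡ true
  blowUp-arc x y = Equivalence.to (T-≡ {blowUp-edge x y})

  blowUp-oriented : IsOriented blowUp
  blowUp-oriented = (λ x → subst T (edge-loopless (vertex x)))
                  , (λ x y xy → subst T (edge-antisym (vertex x) (vertex y) (blowUp-arc x y xy)))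

  blowUp-outdegree : ∀ x → outdeg blowUp x ≡ m + r
  blowUp-outdegree x = trans (outdeg-booleanDigraph blowUp-edge x) (vertex-outdegree (vertex x))

  blowUp-indegree : ∀ x → indeg blowUp x ≡ m + r
  blowUp-indegree x = trans (indeg-booleanDigraph blowUp-edge x) (vertex-indegree (vertex x))

  blowUp-noAntiDirectedHamCycle : Fin m → ¬ AntiDirectedHamCycle blowUp
  blowUp-noAntiDirectedHamCycle i H = case trans (sym (src-part A)) (trans src-agree (src-part C)) of λ ()
    where
    part : Fin (4 * m) → Part
    part = proj₁ ∘ vertex

    part-index : ∀ p → part (index (p , i)) ≡ p
    part-index p = cong proj₁ (vertex-index (p , i))

    src-part : ∀ p → src (part (index (p , i))) ≡ src p
    src-part p = cong src (part-index p)

    balanced : ∀ p → src p ≡ snk p → src (part (index (p , i))) ≡ snk (part (index (p , i)))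
    balanced p src≡snk = subst (λ p' → src p' ≡ snk p') (sym (part-index p)) src≡snk

    src-agree : src (part (index (A , i))) ≡ src (part (index (C , i)))
    src-agree = antiDirectedHamCycle⇒balanced-agree blowUp (src ∘ part) (snk ∘ part)
                  (λ x y xy → edge⇒src≡snk (vertex x) (vertex y) (blowUp-arc x y xy))
                  H (index (A , i)) (index (C , i)) (balanced A refl) (balanced C refl)

private
  8[1+2k+k]+4≡3[4[1+2k]] : ∀ k → 8 * (suc (k * 2) + k) + 4 ≡ 3 * (4 * suc (k * 2))
  8[1+2k+k]+4≡3[4[1+2k]] = solve-∀

  k≤4[1+2k] : ∀ k → k ≤ 4 * suc (k * 2)
  k≤4[1+2k] k = ≤-trans (k≤1+2k k) (m≤m+n (suc (k * 2)) _)

mainTheorem6 : ∀ (m : ℕ) → Σ ℕ λ n → n ≥ m × Σ (Digraph n) λ G → Σ ℕ λ d →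
                 IsOriented G × MinSemidegree G d × 8 * d + 4 ≡ 3 * n
                 × ¬ AntiDirectedHamCycle G
mainTheorem6 k =
  4 * suc (k * 2) , k≤4[1+2k] k , blowUp , suc (k * 2) + k , blowUp-oriented
  , regular⇒minSemidegree blowUp _ zero blowUp-outdegree blowUp-indegree
  , 8[1+2k+k]+4≡3[4[1+2k]] k , blowUp-noAntiDirectedHamCycle zero
  where
  open BlowUp (tournament k) (tournament-irrefl k) (tournament-antisym k)
              (tournament-outdegree k) (tournament-indegree k)
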